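{- Let $G$ be a graph on $n$ vertices and let $\ell:E(G)\to\mathbb R$ be a labeling of its edges such that in every $4$-cycle of $G$, any edge with the smallest $\ell$-value in the cycle and any edge with the largest $\ell$-value in the cycle are adjacent (share a vertex). Then $G$ does not contain a complete bipartite graph with parts of sizes $3$ and $17$ as a subgraph. -}

module Defs where

open import Level using (Level; _⊔_)
open import Data.Bool using (Bool; true; false; T)
open import Data.Fin using (Fin; zero; suc)
open import Data.Sum using (_⊎_)
open import Data.Product using (_×_; Σ)
open import Data.Nat using (ℕ)
open import Relation.Binary.PropositionalEquality using (_≡_; _≢_)
open import Relation.Binary.Bundles using (TotalOrder)
open import Function.Definitions using (Injective)

record SimpleGraph (n : ℕ) : Set where
  field
    adj    : Fin n → Fin n → Bool
    sym    : ∀ u v → adj u v ≡ adj v u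
    irrefl : ∀ v → adj v v ≡ false

module _ {n : ℕ} (G : SimpleGraph n) where
  open SimpleGraph G

  -- u v is an edge of G (a proposition, since T b has at most one proof)
  Edge : Fin n → Fin n → Set
  Edge u v = T (adj u v)

  ContainsKbip : ℕ → ℕ → Set
  ContainsKbip s t =
    Σ (Fin s → Fin n) λ f →
    Σ (Fin t → Fin n) λ g →
      Injective _≡_ _≡_ f × Injective _≡_ _≡_ g
      × (∀ i j → f i ≢ g j)
      × (∀ i j → Edge (f i) (g j))

  -- A labeling ℓ : E(G) → A of the edges of G with values in a totally
  -- ordered set; the label of an (undirected) edge does not depend on
  -- the orientation in which it is written.
  record EdgeLabeling {a ℓ₁ ℓ₂ : Level} (O : TotalOrder a ℓ₁ ℓ₂) : Set (a ⊔ ℓ₁) where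
    open TotalOrder O
    field
      lab     : (u v : Fin n) → Edge u v → Carrier
      lab-sym : ∀ u v (e : Edge u v) (e' : Edge v u) → lab u v e ≈ lab v u e'

  next4 : Fin 4 → Fin 4
  next4 zero = suc zero
  next4 (suc zero) = suc (suc zero)
  next4 (suc (suc zero)) = suc (suc (suc zero))
  next4 (suc (suc (suc zero))) = zero

  -- A 4-cycle v0 v1 v2 v3 of G: four distinct vertices with
  -- v_i v_{i+1 mod 4} ∈ E(G). Edge number i of the cycle is {v_i, v_{i+1}}.
  record Cycle4 : Set where
    field
      vtx  : Fin 4 → Fin n
      inj  : Injective _≡_ _≡_ vtx
      edge : ∀ i → Edge (vtx i) (vtx (next4 i))

  ShareVertex : Cycle4 → Fin 4 → Fin 4 → Set
  ShareVertex C i j =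
      (vtx i ≡ vtx j) ⊎ (vtx i ≡ vtx (next4 j))
    ⊎ (vtx (next4 i) ≡ vtx j) ⊎ (vtx (next4 i) ≡ vtx (next4 j))
    where open Cycle4 C

  MinMaxAdjacent : {a ℓ₁ ℓ₂ : Level} (O : TotalOrder a ℓ₁ ℓ₂) →
                   EdgeLabeling O → Set ℓ₂
  MinMaxAdjacent O L =
    ∀ (C : Cycle4) (i j : Fin 4) →
      (∀ k → cl C i ≤ cl C k) →
      (∀ k → cl C k ≤ cl C j) →
      ShareVertex C i j
    where
      open TotalOrder O
      open EdgeLabeling L
      cl : Cycle4 → Fin 4 → Carrier
      cl C i = lab (Cycle4.vtx C i) (Cycle4.vtx C (next4 i)) (Cycle4.edge C i)

module Submission where

-- Suppose rows f 0, f 1, f 2 and columns g 0 … g 16 span a K_{3,17}, and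
-- write ℓ i b for the label of the edge f i – g b.
--  * In a 4-cycle the edges 0 and 2 are disjoint, so edge 0 cannot be the
--    minimum while edge 2 is the maximum.  Applied to the cycle
--    f i, g b, f j, g b' this says that the 2×2 label matrix on rows i, j
--    and columns b, b' is never "doubly monotone" (top-left entry the
--    minimum and bottom-right entry the maximum).
--  * Give each column b a signature in Fin 8: for each of the three pairs
--    of rows, the direction in which totality compares ℓ i b with ℓ j b.
--    If there are more than 8 columns (in particular 17), two distinct
--    columns b, b' share their signature.
--  * Among the three rows, two move in the same direction from column b to
--    column b'; for that pair of rows both columns also compare the same
--    way, so their 2×2 matrix is doubly monotone — a contradiction.

open import Defs
open import Level using (Level)
open import Data.Nat using (ℕ; _<_)
open import Data.Nat.Properties using (_<?_)
open import Data.Fin using (Fin; zero; suc; combine)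
open import Data.Fin.Properties using (pigeonhole; <⇒≢; combine-injective)
open import Data.Bool using (T)
open import Data.Sum using (_⊎_; inj₁; inj₂; [_,_])
open import Data.Product using (_×_; _,_)
open import Data.Empty using (⊥; ⊥-elim)
open import Relation.Nullary using (¬_)
open import Relation.Nullary.Decidable using (from-yes)
open import Relation.Binary.Bundles using (TotalOrder)
open import Relation.Binary.PropositionalEquality
  using (_≡_; _≢_; refl; sym; subst; ≢-sym)
open import Function.Definitions using (Injective)

injective-on-four : {A : Set} (v : Fin 4 → A) →
  let v₀ = v zero ; v₁ = v (suc zero)
      v₂ = v (suc (suc zero)) ; v₃ = v (suc (suc (suc zero))) in
  v₀ ≢ v₁ → v₀ ≢ v₂ → v₀ ≢ v₃ → v₁ ≢ v₂ → v₁ ≢ v₃ → v₂ ≢ v₃ →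
  Injective _≡_ _≡_ v
injective-on-four v d01 d02 d03 d12 d13 d23 = injective
  where
  injective : Injective _≡_ _≡_ v
  injective {zero}                {zero}                _ = refl
  injective {suc zero}            {suc zero}            _ = refl
  injective {suc (suc zero)}      {suc (suc zero)}      _ = refl
  injective {suc (suc (suc zero))} {suc (suc (suc zero))} _ = refl
  injective {zero}                {suc zero}            e = ⊥-elim (d01 e)
  injective {zero}                {suc (suc zero)}      e = ⊥-elim (d02 e)
  injective {zero}                {suc (suc (suc zero))} e = ⊥-elim (d03 e)
  injective {suc zero}            {suc (suc zero)}      e = ⊥-elim (d12 e)
  injective {suc zero}            {suc (suc (suc zero))} e = ⊥-elim (d13 e)
  injective {suc (suc zero)}      {suc (suc (suc zero))} e = ⊥-elim (d23 e)
  injective {suc zero}            {zero}                e = ⊥-elim (d01 (sym e))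
  injective {suc (suc zero)}      {zero}                e = ⊥-elim (d02 (sym e))
  injective {suc (suc (suc zero))} {zero}                e = ⊥-elim (d03 (sym e))
  injective {suc (suc zero)}      {suc zero}            e = ⊥-elim (d12 (sym e))
  injective {suc (suc (suc zero))} {suc zero}            e = ⊥-elim (d13 (sym e))
  injective {suc (suc (suc zero))} {suc (suc zero)}      e = ⊥-elim (d23 (sym e))

SameBox : ∀ {ι p q} {I : Set ι} (P : I → Set p) (Q : I → Set q) → I → I → Set _
SameBox P Q i j = (P i × P j) ⊎ (Q i × Q j)

two-in-a-box : ∀ {p q} {P : Fin 3 → Set p} {Q : Fin 3 → Set q} →
  (∀ k → P k ⊎ Q k) →
  SameBox P Q zero (suc zero) ⊎ SameBox P Q zero (suc (suc zero))
    ⊎ SameBox P Q (suc zero) (suc (suc zero))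
two-in-a-box box with box zero | box (suc zero) | box (suc (suc zero))
... | inj₁ p₀ | inj₁ p₁ | _       = inj₁ (inj₁ (p₀ , p₁))
... | inj₂ q₀ | inj₂ q₁ | _       = inj₁ (inj₂ (q₀ , q₁))
... | inj₁ p₀ | inj₂ _  | inj₁ p₂ = inj₂ (inj₁ (inj₁ (p₀ , p₂)))
... | inj₂ q₀ | inj₁ _  | inj₂ q₂ = inj₂ (inj₁ (inj₂ (q₀ , q₂)))
... | inj₁ _  | inj₂ q₁ | inj₂ q₂ = inj₂ (inj₂ (inj₂ (q₁ , q₂)))
... | inj₂ _  | inj₁ p₁ | inj₁ p₂ = inj₂ (inj₂ (inj₁ (p₁ , p₂)))

module Comparison {a ℓ₁ ℓ₂ : Level} (O : TotalOrder a ℓ₁ ℓ₂) where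
  open TotalOrder O

  -- This is a function of x and y, so it can be recorded
  -- in a finite signature even though ≤ need not be decidable.
  side : Carrier → Carrier → Fin 2
  side x y = [ (λ _ → zero) , (λ _ → suc zero) ] (total x y)

  same-side : ∀ {x y x' y'} → side x y ≡ side x' y' →
              (x ≤ y × x' ≤ y') ⊎ (y ≤ x × y' ≤ x')
  same-side {x} {y} {x'} {y'} _ with total x y | total x' y'
  same-side () | inj₁ _ | inj₂ _
  same-side () | inj₂ _ | inj₁ _
  ... | inj₁ x≤y | inj₁ x'≤y' = inj₁ (x≤y , x'≤y')
  ... | inj₂ y≤x | inj₂ y'≤x' = inj₂ (y≤x , y'≤x')

module _ {a ℓ₁ ℓ₂ : Level} {O : TotalOrder a ℓ₁ ℓ₂}
         {n : ℕ} {G : SimpleGraph n} (L : EdgeLabeling G O) where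
  open TotalOrder O
  open EdgeLabeling L

  cycle-label : Cycle4 G → Fin 4 → Carrier
  cycle-label C k = lab (Cycle4.vtx C k) (Cycle4.vtx C (next4 G k)) (Cycle4.edge C k)

  -- Edges 0 and 2 of a 4-cycle share no vertex, so under MinMaxAdjacent
  -- edge 0 cannot be a minimum of the cycle while edge 2 is a maximum.
  opposite-extremes-impossible : MinMaxAdjacent G O L → (C : Cycle4 G) →
    (∀ k → cycle-label C zero ≤ cycle-label C k) →
    (∀ k → cycle-label C k ≤ cycle-label C (suc (suc zero))) → ⊥
  opposite-extremes-impossible minmax C min₀ max₂
    with minmax C zero (suc (suc zero)) min₀ max₂
  ... | inj₁ v₀≡v₂               with () ← Cycle4.inj C v₀≡v₂
  ... | inj₂ (inj₁ v₀≡v₃)        with () ← Cycle4.inj C v₀≡v₃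
  ... | inj₂ (inj₂ (inj₁ v₁≡v₂)) with () ← Cycle4.inj C v₁≡v₂
  ... | inj₂ (inj₂ (inj₂ v₁≡v₃)) with () ← Cycle4.inj C v₁≡v₃

module Bipartite {a ℓ₁ ℓ₂ : Level} {O : TotalOrder a ℓ₁ ℓ₂}
    {n : ℕ} {G : SimpleGraph n} (L : EdgeLabeling G O)
    (minmax : MinMaxAdjacent G O L) {s t : ℕ}
    (f : Fin s → Fin n) (g : Fin t → Fin n)
    (f-inj : Injective _≡_ _≡_ f) (g-inj : Injective _≡_ _≡_ g)
    (disjoint : ∀ i b → f i ≢ g b) (edge : ∀ i b → Edge G (f i) (g b)) where
  open TotalOrder O renaming (refl to ≤-refl; trans to ≤-trans)
  open EdgeLabeling L
  open Comparison O using (side; same-side)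

  ℓ : Fin s → Fin t → Carrier
  ℓ i b = lab (f i) (g b) (edge i b)

  edge-back : ∀ i b → Edge G (g b) (f i)
  edge-back i b = subst T (SimpleGraph.sym G (f i) (g b)) (edge i b)

  square : ∀ {i j b b'} → i ≢ j → b ≢ b' → Cycle4 G
  square {i} {j} {b} {b'} i≢j b≢b' = record
    { vtx  = vtx
    ; inj  = injective-on-four vtx
               (disjoint i b) (λ e → i≢j (f-inj e)) (disjoint i b')
               (λ e → disjoint j b (sym e)) (λ e → b≢b' (g-inj e)) (disjoint j b')
    ; edge = λ { zero → edge i b ; (suc zero) → edge-back j b
               ; (suc (suc zero)) → edge j b' ; (suc (suc (suc zero))) → edge-back i b' }
    }
    where
    vtx : Fin 4 → Fin n
    vtx zero                   = f i
    vtx (suc zero)             = g b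
    vtx (suc (suc zero))       = f j
    vtx (suc (suc (suc zero))) = g b'

  -- No 2×2 label matrix is doubly monotone: if both rows i, j rise from
  -- column b to b' and row j dominates row i in both columns, then ℓ i b is
  -- the minimum and ℓ j b' the maximum of the square, which are opposite edges.
  no-monotone-square : ∀ {i j b b'} → i ≢ j → b ≢ b' →
    ℓ i b ≤ ℓ i b' → ℓ j b ≤ ℓ j b' → ℓ i b ≤ ℓ j b → ℓ i b' ≤ ℓ j b' → ⊥
  no-monotone-square {i} {j} {b} {b'} i≢j b≢b' ib≤ib' jb≤jb' ib≤jb ib'≤jb' =
    opposite-extremes-impossible L minmax C minimum maximum
    where
    C = square i≢j b≢b'
    -- the two edges of the cycle that were written from column to row
    edge₁ : cycle-label L C (suc zero) ≈ ℓ j b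
    edge₁ = lab-sym (g b) (f j) (edge-back j b) (edge j b)
    edge₃ : cycle-label L C (suc (suc (suc zero))) ≈ ℓ i b'
    edge₃ = lab-sym (g b') (f i) (edge-back i b') (edge i b')

    minimum : ∀ k → ℓ i b ≤ cycle-label L C k
    minimum zero                   = ≤-refl
    minimum (suc zero)             = ≤-trans ib≤jb (reflexive (Eq.sym edge₁))
    minimum (suc (suc zero))       = ≤-trans ib≤ib' ib'≤jb'
    minimum (suc (suc (suc zero))) = ≤-trans ib≤ib' (reflexive (Eq.sym edge₃))

    maximum : ∀ k → cycle-label L C k ≤ ℓ j b'
    maximum zero                   = ≤-trans ib≤ib' ib'≤jb'
    maximum (suc zero)             = ≤-trans (reflexive edge₁) jb≤jb'
    maximum (suc (suc zero))       = ≤-refl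
    maximum (suc (suc (suc zero))) = ≤-trans (reflexive edge₃) ib'≤jb'

  Rises Falls : Fin t → Fin t → Fin s → Set ℓ₂
  Rises b b' k = ℓ k b ≤ ℓ k b'
  Falls b b' k = ℓ k b' ≤ ℓ k b

  -- If rows i and j compare the same way in columns b and b' and move in the
  -- same direction between them, one of the four orientations of their
  -- 2×2 matrix is doubly monotone.
  aligned-rows-impossible : ∀ {i j b b'} → i ≢ j → b ≢ b' →
    side (ℓ i b) (ℓ j b) ≡ side (ℓ i b') (ℓ j b') →
    SameBox (Rises b b') (Falls b b') i j → ⊥
  aligned-rows-impossible i≢j b≢b' same moves with same-side same | moves
  ... | inj₁ (ib≤jb , ib'≤jb') | inj₁ (ib≤ib' , jb≤jb') =
    no-monotone-square i≢j b≢b' ib≤ib' jb≤jb' ib≤jb ib'≤jb'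
  ... | inj₁ (ib≤jb , ib'≤jb') | inj₂ (ib'≤ib , jb'≤jb) =
    no-monotone-square i≢j (≢-sym b≢b') ib'≤ib jb'≤jb ib'≤jb' ib≤jb
  ... | inj₂ (jb≤ib , jb'≤ib') | inj₁ (ib≤ib' , jb≤jb') =
    no-monotone-square (≢-sym i≢j) b≢b' jb≤jb' ib≤ib' jb≤ib jb'≤ib'
  ... | inj₂ (jb≤ib , jb'≤ib') | inj₂ (ib'≤ib , jb'≤jb) =
    no-monotone-square (≢-sym i≢j) (≢-sym b≢b') jb'≤jb ib'≤ib jb'≤ib' jb≤ib

module ThreeRows {a ℓ₁ ℓ₂ : Level} {O : TotalOrder a ℓ₁ ℓ₂}
    {n : ℕ} {G : SimpleGraph n} (L : EdgeLabeling G O)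
    (minmax : MinMaxAdjacent G O L) {t : ℕ}
    (f : Fin 3 → Fin n) (g : Fin t → Fin n)
    (f-inj : Injective _≡_ _≡_ f) (g-inj : Injective _≡_ _≡_ g)
    (disjoint : ∀ i b → f i ≢ g b) (edge : ∀ i b → Edge G (f i) (g b)) where
  open TotalOrder O using (total)
  open Comparison O using (side)
  open Bipartite L minmax f g f-inj g-inj disjoint edge

  signature : Fin t → Fin 8
  signature b = combine (combine (side (ℓ r₀ b) (ℓ r₁ b)) (side (ℓ r₀ b) (ℓ r₂ b)))
                        (side (ℓ r₁ b) (ℓ r₂ b))
    where
    r₀ r₁ r₂ : Fin 3
    r₀ = zero
    r₁ = suc zero
    r₂ = suc (suc zero)

  -- Distinct columns have distinct signatures: equal signatures make every
  -- pair of rows compare the same way in both columns, and by pigeonhole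
  -- two rows also move in the same direction between the columns.
  signature-injective : ∀ {b b'} → b ≢ b' → signature b ≢ signature b'
  signature-injective {b} {b'} b≢b' same
    with combine-injective _ _ _ _ same
  ... | same₀₁₀₂ , same₁₂
    with combine-injective _ _ _ _ same₀₁₀₂
  ... | same₀₁ , same₀₂
    with two-in-a-box (λ k → total (ℓ k b) (ℓ k b'))
  ... | inj₁ moves₀₁        = aligned-rows-impossible (λ ()) b≢b' same₀₁ moves₀₁
  ... | inj₂ (inj₁ moves₀₂) = aligned-rows-impossible (λ ()) b≢b' same₀₂ moves₀₂
  ... | inj₂ (inj₂ moves₁₂) = aligned-rows-impossible (λ ()) b≢b' same₁₂ moves₁₂

  at-most-eight-columns : 8 < t → ⊥
  at-most-eight-columns 8<t
    with b , b' , b<b' , same ← pigeonhole 8<t signature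
    = signature-injective (<⇒≢ b<b') same

lemma3p3 : {a ℓ₁ ℓ₂ : Level} (O : TotalOrder a ℓ₁ ℓ₂)
           (n : ℕ) (G : SimpleGraph n) (L : EdgeLabeling G O) →
           MinMaxAdjacent G O L →
           ¬ ContainsKbip G 3 17
lemma3p3 O n G L minmax (f , g , f-inj , g-inj , disjoint , edge) =
  ThreeRows.at-most-eight-columns L minmax f g f-inj g-inj disjoint edge
    (from-yes (8 <? 17))
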